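{- Let $G$ be a finite, simple, loopless, regular, connected graph with $\operatorname{diam}(G)\geq 3$. Then \[ e(G^3) \geq \left(1+\frac{1}{6}\right) e(G). \]
   Context: For vertices $u,v$ of $G$, $\operatorname{dist}(u,v)$ is the length of a shortest path between them. The cube $G^3$ of $G$ is the graph on $V(G)$ in which two distinct vertices $x,y$ are adjacent if and only if $\operatorname{dist}(x,y)\leq 3$ in $G$. The diameter $\operatorname{diam}(G)$ is the maximum distance between two vertices of $G$. $e(H)$ denotes the number of edges of a graph $H$. -}

module Defs where

open import Data.Nat using (ℕ; zero; suc; _+_; _*_; _≤_; _<ᵇ_)
open import Data.Bool using (Bool; true; false; _∧_; _∨_; not; if_then_else_; T)
open import Data.Fin using (Fin; toℕ) renaming (_≟_ to _≟F_)
open import Data.List using (List; map; filter; length; allFin)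
open import Data.Nat.ListAction using (sum)
open import Data.Bool.ListAction using (any)
open import Data.Product using (Σ; ∃; _×_; _,_)
open import Relation.Nullary using (¬_; does)
open import Data.Bool.Properties using (T?)
open import Relation.Binary.PropositionalEquality using (_≡_)

record Graph (n : ℕ) : Set where
  field
    adj   : Fin n → Fin n → Bool
    sym   : ∀ u v → adj u v ≡ adj v u
    irrefl : ∀ v → adj v v ≡ false
open Graph public

-- reach G k u v = true  iff  there is a walk of length ≤ k from u to v,
-- i.e. iff dist(u,v) ≤ k.
reach : ∀ {n} → Graph n → ℕ → Fin n → Fin n → Bool
reach G zero    u v = does (u ≟F v)
reach G (suc k) u v = reach G k u v ∨ any (λ w → reach G k u w ∧ adj G w v) (allFin _)

DistLe : ∀ {n} → Graph n → ℕ → Fin n → Fin n → Set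
DistLe G k u v = T (reach G k u v)

degree : ∀ {n} → Graph n → Fin n → ℕ
degree G v = length (filter (λ w → T? (adj G v w)) (allFin _))

countEdges : ∀ {n} → (Fin n → Fin n → Bool) → ℕ
countEdges {n} a =
  sum (map (λ u → sum (map (λ v → if (toℕ u <ᵇ toℕ v) ∧ a u v then 1 else 0)
                            (allFin n)))
           (allFin n))

e : ∀ {n} → Graph n → ℕ
e G = countEdges (adj G)

cubeAdj : ∀ {n} → Graph n → Fin n → Fin n → Bool
cubeAdj G x y = not (does (x ≟F y)) ∧ reach G 3 x y

e-cube : ∀ {n} → Graph n → ℕ
e-cube G = countEdges (cubeAdj G)

Regular : ∀ {n} → Graph n → Set
Regular {n} G = ∃ λ d → ∀ v → degree G v ≡ d

Connected : ∀ {n} → Graph n → Set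
Connected {n} G = ∀ u v → ∃ λ k → DistLe G k u v

DiamGe3 : ∀ {n} → Graph n → Set
DiamGe3 {n} G = ∃ λ u → ∃ λ v → ¬ DistLe G 2 u v

module Submission where

-- For a vertex v let far(v) be the set of vertices x with 2 ≤ dist(v,x) ≤ 3
-- and D(v) = |far(v)|.  Every G³-neighbour of v is a G-neighbour or lies in
-- far(v), so 2·e(G³) = n·d + Σ_v D(v), while 2·e(G) = n·d; the theorem is
-- therefore equivalent to  n·d ≤ 6·Σ_v D(v).
--
-- This follows by summing the local bound  d² ≤ 3·(d·D(v) + Σ_{a ~ v} D(a)),
-- since Σ_v Σ_{a ~ v} D(a) = d·Σ_v D(v) by regularity.  The local bound is
-- proved by comparing closed neighbourhoods (each of size d + 1):
--  (B) if every vertex is within distance 2 of v, two vertices p, q at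
--      distance ≥ 3 have disjoint closed neighbourhoods inside N[v] ∪ far(v),
--      whence D(v) ≥ d + 1;
--  (A) otherwise, by connectivity there are b, y with dist(v,b) = 2,
--      dist(v,y) = 3 and b ~ y.  N[b] lies in (N(v) ∩ N(b)) ∪ far(v), and for
--      each common neighbour a of v and b, N[y] lies in far(v) ∪ far(a) with y
--      in both; an elementary inequality then gives the bound.

open import Defs hiding (sym)
open import Data.Nat using (ℕ; zero; suc; _+_; _*_; _∸_; _≤_; _<_; _<ᵇ_; _≤?_; z≤n; s≤s)
open import Data.Nat.Properties hiding (_≟_)
open import Data.Nat.Tactic.RingSolver using (solve-∀)
open import Data.Bool using (Bool; true; false; _∧_; _∨_; not; if_then_else_; T)
open import Data.Bool.Properties using (T?; T-∧; T-∨; T-≡; ∧-zeroʳ)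
open import Data.Unit using (tt)
open import Data.Fin using (Fin; zero; suc; toℕ; _≟_)
open import Data.Fin.Properties using (toℕ-injective; all?; ¬∀⟶∃¬)
open import Data.List using (List; []; _∷_; map; filter; length; allFin; tabulate)
open import Data.List.Properties using (map-tabulate)
open import Data.List.Relation.Unary.Any using (satisfied)
open import Data.List.Relation.Unary.Any.Properties using (any⁺; any⁻)
open import Data.List.Membership.Propositional using (lose)
open import Data.List.Membership.Propositional.Properties using (∈-allFin)
open import Data.Nat.ListAction using () renaming (sum to listSum)
open import Algebra.Properties.Semiring.Sum +-*-semiring
  using (sum; sum-syntax; sum-cong-≗; sum-replicate-zero; ∑-distrib-+; ∑-comm; *-distribˡ-sum; *-distribʳ-sum)
open import Data.Product using (∃; _×_; _,_; proj₁)
open import Data.Sum using (_⊎_; inj₁; inj₂)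
open import Data.Empty using (⊥-elim)
open import Relation.Nullary using (¬_; Dec; does; yes; no; _because_; map′; contradiction)
open import Relation.Nullary.Decidable using (dec-true; dec-false)
open import Relation.Nullary.Reflects using (invert)
open import Relation.Binary using (tri<; tri≈; tri>)
open import Relation.Binary.PropositionalEquality
open import Function using (_∘_; id)
open import Function.Bundles using (Equivalence)

does⇒ : ∀ {A : Set} (a? : Dec A) → T (does a?) → A
does⇒ (true because [a]) _ = invert [a]

⇒does : ∀ {A : Set} (a? : Dec A) → A → T (does a?)
⇒does (true because _) _ = tt
⇒does (false because [¬a]) a = invert [¬a] a

¬⇒not-does : ∀ {A : Set} (a? : Dec A) → ¬ A → T (not (does a?))
¬⇒not-does (true because [a]) ¬a = ¬a (invert [a])
¬⇒not-does (false because _) _ = tt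

not-does⇒¬ : ∀ {A : Set} (a? : Dec A) → T (not (does a?)) → ¬ A
not-does⇒¬ (false because [¬a]) _ = invert [¬a]

T-not : ∀ {b} → ¬ T b → T (not b)
T-not {true} ¬t = ¬t tt
T-not {false} _ = tt

T-extensional : ∀ {a b} → (T a → T b) → (T b → T a) → a ≡ b
T-extensional {true} {true} _ _ = refl
T-extensional {true} {false} a⇒b _ = ⊥-elim (a⇒b tt)
T-extensional {false} {true} _ b⇒a = ⊥-elim (b⇒a tt)
T-extensional {false} {false} _ _ = refl

-- Indicators.  ⟦ b ⟧ ∈ {0,1}; every cardinality below is a sum of indicators,
-- and inclusions between sets become pointwise inequalities between them.

⟦_⟧ : Bool → ℕ
⟦ b ⟧ = if b then 1 else 0

⟦⟧-true : ∀ {b} → T b → ⟦ b ⟧ ≡ 1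
⟦⟧-true {true} _ = refl

⟦⟧-mono : ∀ {a b} → (T a → T b) → ⟦ a ⟧ ≤ ⟦ b ⟧
⟦⟧-mono {false} _ = z≤n
⟦⟧-mono {true} a⇒b rewrite ⟦⟧-true (a⇒b tt) = ≤-refl

⟦⟧-∨ : ∀ a b → ⟦ a ∨ b ⟧ ≤ ⟦ a ⟧ + ⟦ b ⟧
⟦⟧-∨ true _ = s≤s z≤n
⟦⟧-∨ false _ = ≤-refl

⟦⟧-cover : ∀ {a} b c → (T a → T (b ∨ c)) → ⟦ a ⟧ ≤ ⟦ b ⟧ + ⟦ c ⟧
⟦⟧-cover b c cov = ≤-trans (⟦⟧-mono cov) (⟦⟧-∨ b c)

⟦⟧-disjoint : ∀ a b → (T a → ¬ T b) → ⟦ a ∨ b ⟧ ≡ ⟦ a ⟧ + ⟦ b ⟧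
⟦⟧-disjoint true true disj = ⊥-elim (disj tt tt)
⟦⟧-disjoint true false _ = refl
⟦⟧-disjoint false _ _ = refl

⟦⟧-∨∧ : ∀ a b → ⟦ a ⟧ + ⟦ b ⟧ ≡ ⟦ a ∨ b ⟧ + ⟦ a ∧ b ⟧
⟦⟧-∨∧ true true = refl
⟦⟧-∨∧ true false = refl
⟦⟧-∨∧ false true = refl
⟦⟧-∨∧ false false = refl

⟦⟧-split : ∀ a b → (T a → T b) → ⟦ b ⟧ ≡ ⟦ a ⟧ + ⟦ b ∧ not a ⟧
⟦⟧-split true true _ = refl
⟦⟧-split true false a⇒b = ⊥-elim (a⇒b tt)
⟦⟧-split false true _ = refl
⟦⟧-split false false _ = refl

⟦⟧-weighted : ∀ {a b} k l m → (T a → T b) → (T a → k ≤ l + m) →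
  ⟦ a ⟧ * k ≤ ⟦ a ⟧ * l + ⟦ b ⟧ * m
⟦⟧-weighted {false} _ _ _ _ _ = z≤n
⟦⟧-weighted {true} k l m a⇒b bound
  rewrite ⟦⟧-true (a⇒b tt) | *-identityˡ k | *-identityˡ l | *-identityˡ m = bound tt

∑-mono : ∀ {n} {f g : Fin n → ℕ} → (∀ i → f i ≤ g i) → ∑[ i < n ] f i ≤ ∑[ i < n ] g i
∑-mono {zero} _ = z≤n
∑-mono {suc n} f≤g = +-mono-≤ (f≤g zero) (∑-mono (f≤g ∘ suc))

∑-const : ∀ n k → ∑[ i < n ] k ≡ n * k
∑-const zero _ = refl
∑-const (suc n) k = cong (k +_) (∑-const n k)

∑-singleton : ∀ {n} (u : Fin n) → ∑[ x < n ] ⟦ does (x ≟ u) ⟧ ≡ 1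
∑-singleton {suc n} zero = cong suc (sum-replicate-zero n)
∑-singleton {suc n} (suc u) = ∑-singleton u

listSum-tabulate : ∀ {m} (h : Fin m → ℕ) → listSum (tabulate h) ≡ ∑[ i < m ] h i
listSum-tabulate {zero} _ = refl
listSum-tabulate {suc m} h = cong (h zero +_) (listSum-tabulate (h ∘ suc))

listSum-allFin : ∀ {n} (f : Fin n → ℕ) → listSum (map f (allFin n)) ≡ ∑[ i < n ] f i
listSum-allFin {n} f = trans (cong listSum (map-tabulate id f)) (listSum-tabulate f)

length-filter : ∀ {A : Set} (p : A → Bool) (xs : List A) →
  length (filter (T? ∘ p) xs) ≡ listSum (map (⟦_⟧ ∘ p) xs)
length-filter p [] = refl
length-filter p (x ∷ xs) with p x
... | true = cong suc (length-filter p xs)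
... | false = length-filter p xs

below : ∀ {n} → Fin n → Fin n → Bool
below u v = toℕ u <ᵇ toℕ v

countEdges-∑ : ∀ {n} (r : Fin n → Fin n → Bool) →
  countEdges r ≡ ∑[ u < n ] ∑[ v < n ] ⟦ below u v ∧ r u v ⟧
countEdges-∑ {n} r = trans (listSum-allFin {n} _) (sum-cong-≗ {n} (λ u → listSum-allFin {n} _))

split-ordered-pair : ∀ {n} (r : Fin n → Fin n → Bool) →
  (∀ u v → r u v ≡ r v u) → (∀ u → r u u ≡ false) →
  ∀ u v → ⟦ r u v ⟧ ≡ ⟦ below u v ∧ r u v ⟧ + ⟦ below v u ∧ r v u ⟧
split-ordered-pair r r-sym r-irrefl u v with <-cmp (toℕ u) (toℕ v)
... | tri< u<v _ v≮u
  rewrite Equivalence.to T-≡ (<⇒<ᵇ u<v) | dec-false (T? (below v u)) (v≮u ∘ <ᵇ⇒< _ _) =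
  sym (+-identityʳ _)
... | tri> u≮v _ v<u
  rewrite Equivalence.to T-≡ (<⇒<ᵇ v<u) | dec-false (T? (below u v)) (u≮v ∘ <ᵇ⇒< _ _) | r-sym u v =
  refl
... | tri≈ _ u≡v _ with toℕ-injective u≡v
...   | refl rewrite r-irrefl u | ∧-zeroʳ (below u u) = refl

handshake : ∀ {n} (r : Fin n → Fin n → Bool) →
  (∀ u v → r u v ≡ r v u) → (∀ u → r u u ≡ false) →
  ∑[ u < n ] ∑[ v < n ] ⟦ r u v ⟧ ≡ 2 * countEdges r
handshake {n} r r-sym r-irrefl = begin
  ∑[ u < n ] ∑[ v < n ] ⟦ r u v ⟧
    ≡⟨ sum-cong-≗ {n} (λ u → trans (sum-cong-≗ {n} (split-ordered-pair r r-sym r-irrefl u))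
                                    (∑-distrib-+ (λ v → ⟦ below u v ∧ r u v ⟧) (λ v → ⟦ below v u ∧ r v u ⟧))) ⟩
  ∑[ u < n ] (Up u + ∑[ v < n ] ⟦ below v u ∧ r v u ⟧)
    ≡⟨ ∑-distrib-+ Up _ ⟩
  sum Up + ∑[ u < n ] ∑[ v < n ] ⟦ below v u ∧ r v u ⟧
    ≡⟨ cong (sum Up +_) (∑-comm (λ u v → ⟦ below v u ∧ r v u ⟧)) ⟩
  sum Up + sum Up
    ≡⟨ cong (λ m → m + m) (sym (countEdges-∑ r)) ⟩
  countEdges r + countEdges r
    ≡⟨ cong (countEdges r +_) (sym (+-identityʳ _)) ⟩
  2 * countEdges r ∎
  where
  open ≡-Reasoning
  Up : Fin n → ℕ
  Up u = ∑[ v < n ] ⟦ below u v ∧ r u v ⟧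

-- Write m = d + 1 ∸ k for the
-- deficit of k below d + 1.  The two counting facts of case (A) force m² ≤ S,
-- and d² ≤ 3·(d·k + m²) holds for all d and k.

deficit-square : ∀ d k c S → suc d ≤ c + k → c * suc (suc d) ≤ c * k + S →
  (suc d ∸ k) * (suc d ∸ k) ≤ S
deficit-square d k c S size weight = begin
  m * m                    ≤⟨ *-monoˡ-≤ m m≤c ⟩
  c * m                    ≤⟨ *-monoʳ-≤ c (∸-monoˡ-≤ k (n≤1+n (suc d))) ⟩
  c * (suc (suc d) ∸ k)    ≡⟨ *-distribˡ-∸ c (suc (suc d)) k ⟩
  c * suc (suc d) ∸ c * k  ≤⟨ ∸-monoˡ-≤ (c * k) weight ⟩
  c * k + S ∸ c * k        ≡⟨ m+n∸m≡n (c * k) S ⟩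
  S                        ∎
  where
  open ≤-Reasoning
  m : ℕ
  m = suc d ∸ k
  m≤c : m ≤ c
  m≤c = subst (m ≤_) (m+n∸n≡m c k) (∸-monoˡ-≤ k size)

-- d² ≤ 3·d·k when d ≤ 3k, and otherwise 2d ≤ 3m, so that 4d² ≤ 9m²
square-bound : ∀ d k → d * d ≤ 3 * (d * k + (suc d ∸ k) * (suc d ∸ k))
square-bound d k with d ≤? 3 * k
... | yes d≤3k = begin
  d * d            ≤⟨ *-monoʳ-≤ d d≤3k ⟩
  d * (3 * k)      ≡⟨ *-comm-3 d k ⟩
  3 * (d * k)      ≤⟨ *-monoʳ-≤ 3 (m≤m+n (d * k) _) ⟩
  3 * (d * k + _)  ∎
  where
  open ≤-Reasoning
  *-comm-3 : ∀ d k → d * (3 * k) ≡ 3 * (d * k)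
  *-comm-3 = solve-∀
... | no d≰3k = ≤-trans d²≤3m² (*-monoʳ-≤ 3 (m≤n+m (m * m) (d * k)))
  where
  open ≤-Reasoning
  m : ℕ
  m = suc d ∸ k
  3k<d : 3 * k < d
  3k<d = ≰⇒> d≰3k
  k+m≡1+d : k + m ≡ suc d
  k+m≡1+d = m+[n∸m]≡n (≤-trans (m≤n*m k 3) (≤-trans (<⇒≤ 3k<d) (n≤1+n d)))
  three-d : ∀ d → d + 2 * d ≡ 3 * d
  three-d = solve-∀
  2d≤3m : 2 * d ≤ 3 * m
  2d≤3m = +-cancelˡ-≤ (3 * k) (2 * d) (3 * m) (begin
    3 * k + 2 * d  ≤⟨ +-monoˡ-≤ (2 * d) (<⇒≤ 3k<d) ⟩
    d + 2 * d      ≡⟨ three-d d ⟩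
    3 * d          ≤⟨ *-monoʳ-≤ 3 (n≤1+n d) ⟩
    3 * suc d      ≡⟨ cong (3 *_) k+m≡1+d ⟨
    3 * (k + m)    ≡⟨ *-distribˡ-+ 3 k m ⟩
    3 * k + 3 * m  ∎)
  square-2 : ∀ x → 4 * (x * x) ≡ (2 * x) * (2 * x)
  square-2 = solve-∀
  square-3 : ∀ x → (3 * x) * (3 * x) ≡ 9 * (x * x)
  square-3 = solve-∀
  twelve : ∀ x → 12 * x ≡ 4 * (3 * x)
  twelve = solve-∀
  d²≤3m² : d * d ≤ 3 * (m * m)
  d²≤3m² = *-cancelˡ-≤ 4 (begin
    4 * (d * d)          ≡⟨ square-2 d ⟩
    (2 * d) * (2 * d)    ≤⟨ *-mono-≤ 2d≤3m 2d≤3m ⟩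
    (3 * m) * (3 * m)    ≡⟨ square-3 m ⟩
    9 * (m * m)          ≤⟨ *-monoˡ-≤ (m * m) (m≤m+n 9 3) ⟩
    12 * (m * m)         ≡⟨ twelve (m * m) ⟩
    4 * (3 * (m * m))    ∎)

near-far-bound : ∀ d k c S → suc d ≤ c + k → c * suc (suc d) ≤ c * k + S →
  d * d ≤ 3 * (d * k + S)
near-far-bound d k c S size weight =
  ≤-trans (square-bound d k) (*-monoʳ-≤ 3 (+-monoʳ-≤ (d * k) (deficit-square d k c S size weight)))

cancel-degree : ∀ n d y → d * (n * d) ≤ d * y → n * d ≤ y
cancel-degree n zero y _ = subst (_≤ y) (sym (*-zeroʳ n)) z≤n
cancel-degree n (suc d) y le = *-cancelˡ-≤ (suc d) le

ratio-bound : ∀ E C N X → 2 * E ≡ N → 2 * C ≡ N + X → N ≤ 6 * X → 7 * E ≤ 6 * C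
ratio-bound E C N X twice-E twice-C N≤6X = *-cancelˡ-≤ 2 (begin
  2 * (7 * E)     ≡⟨ swap-2-7 E ⟩
  7 * (2 * E)     ≡⟨ cong (7 *_) twice-E ⟩
  7 * N           ≡⟨ split-7 N ⟩
  N + 6 * N       ≤⟨ +-monoˡ-≤ (6 * N) N≤6X ⟩
  6 * X + 6 * N   ≡⟨ collect-6 N X ⟩
  6 * (N + X)     ≡⟨ cong (6 *_) twice-C ⟨
  6 * (2 * C)     ≡⟨ swap-6-2 C ⟩
  2 * (6 * C)     ∎)
  where
  open ≤-Reasoning
  swap-2-7 : ∀ x → 2 * (7 * x) ≡ 7 * (2 * x)
  swap-2-7 = solve-∀
  split-7 : ∀ x → 7 * x ≡ x + 6 * x
  split-7 = solve-∀
  collect-6 : ∀ x y → 6 * y + 6 * x ≡ 6 * (x + y)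
  collect-6 = solve-∀
  swap-6-2 : ∀ x → 6 * (2 * x) ≡ 2 * (6 * x)
  swap-6-2 = solve-∀

-- Distances in a graph G.  Dist≤ k u v wraps DistLe G k u v (dist(u,v) ≤ k)
-- in a record so that k, u and v can be inferred from its type.

module Distance {n : ℕ} (G : Graph n) where

  Adj : Fin n → Fin n → Set
  Adj u v = T (adj G u v)

  adj-sym : ∀ {u v} → Adj u v → Adj v u
  adj-sym {u} {v} = subst T (Graph.sym G u v)

  adj-irrefl : ∀ {u} → ¬ Adj u u
  adj-irrefl {u} = subst T (Graph.irrefl G u)

  record Dist≤ (k : ℕ) (u v : Fin n) : Set where
    constructor ⟨_⟩
    field holds : DistLe G k u v
  open Dist≤ public

  dist≤? : ∀ k u v → Dec (Dist≤ k u v)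
  dist≤? k u v = map′ ⟨_⟩ holds (T? (reach G k u v))

  dist-zero : ∀ {u v} → u ≡ v → Dist≤ 0 u v
  dist-zero {u} {v} u≡v = ⟨ ⇒does (u ≟ v) u≡v ⟩

  dist-zero⁻ : ∀ {u v} → Dist≤ 0 u v → u ≡ v
  dist-zero⁻ {u} {v} ⟨ t ⟩ = does⇒ (u ≟ v) t

  dist-weaken : ∀ {k u v} → Dist≤ k u v → Dist≤ (suc k) u v
  dist-weaken ⟨ t ⟩ = ⟨ Equivalence.from T-∨ (inj₁ t) ⟩

  dist-step : ∀ {k u w v} → Dist≤ k u w → Adj w v → Dist≤ (suc k) u v
  dist-step {k} {u} {w} {v} ⟨ t ⟩ a = ⟨ Equivalence.from T-∨ (inj₂ via-w) ⟩
    where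
    via-w = any⁺ (λ x → reach G k u x ∧ adj G x v) (lose (∈-allFin w) (Equivalence.from T-∧ (t , a)))

  dist-split : ∀ {k u v} → Dist≤ (suc k) u v → Dist≤ k u v ⊎ ∃ λ w → Dist≤ k u w × Adj w v
  dist-split {k} {u} {v} ⟨ t ⟩ with Equivalence.to T-∨ t
  ... | inj₁ t′ = inj₁ ⟨ t′ ⟩
  ... | inj₂ via =
    let (w , t′) = satisfied (any⁻ (λ x → reach G k u x ∧ adj G x v) (allFin n) via)
        (r , a) = Equivalence.to T-∧ t′
    in inj₂ (w , ⟨ r ⟩ , a)

  dist-self : ∀ k {u} → Dist≤ k u u
  dist-self zero = dist-zero refl
  dist-self (suc k) = dist-weaken (dist-self k)

  dist-adj : ∀ {u v} → Adj u v → Dist≤ 1 u v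
  dist-adj = dist-step (dist-self 0)

  dist-prepend : ∀ {k u w v} → Adj u w → Dist≤ k w v → Dist≤ (suc k) u v
  dist-prepend {zero} a r with dist-zero⁻ r
  ... | refl = dist-adj a
  dist-prepend {suc k} a r with dist-split r
  ... | inj₁ r′ = dist-weaken (dist-prepend a r′)
  ... | inj₂ (w , r′ , a′) = dist-step (dist-prepend a r′) a′

  dist-sym : ∀ {k u v} → Dist≤ k u v → Dist≤ k v u
  dist-sym {zero} r = dist-zero (sym (dist-zero⁻ r))
  dist-sym {suc k} r with dist-split r
  ... | inj₁ r′ = dist-weaken (dist-sym r′)
  ... | inj₂ (w , r′ , a) = dist-prepend (adj-sym a) (dist-sym r′)

  dist-trans : ∀ {i j u w v} → Dist≤ i u w → Dist≤ j w v → Dist≤ (i + j) u v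
  dist-trans {i} {zero} r r₀ with dist-zero⁻ r₀
  ... | refl rewrite +-identityʳ i = r
  dist-trans {i} {suc j} r r′ rewrite +-suc i j with dist-split r′
  ... | inj₁ r″ = dist-weaken (dist-trans r r″)
  ... | inj₂ (w , r″ , a) = dist-step (dist-trans r r″) a

  sphere-nonempty : ∀ j k {v y} → Dist≤ k v y → ¬ Dist≤ j v y →
    ∃ λ z → Dist≤ (suc j) v z × ¬ Dist≤ j v z
  sphere-nonempty j zero r outside = ⊥-elim (outside (subst (Dist≤ j _) (dist-zero⁻ r) (dist-self j)))
  sphere-nonempty j (suc k) r outside with dist-split r
  ... | inj₁ r′ = sphere-nonempty j k r′ outside
  ... | inj₂ (w , r′ , a) with dist≤? j _ w
  ...   | yes inside = _ , dist-step inside a , outside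
  ...   | no outside′ = sphere-nonempty j k r′ outside′

  distance-three : Connected G → ∀ {v} → ¬ (∀ x → Dist≤ 2 v x) →
    ∃ λ b → ∃ λ y → Dist≤ 2 v b × ¬ Dist≤ 1 v b × Adj b y × ¬ Dist≤ 2 v y
  distance-three connected {v} ¬near
    with ¬∀⟶∃¬ n _ (dist≤? 2 v) ¬near
  ... | x , vx₂̸ with connected v x
  ...   | k , vx with sphere-nonempty 2 k ⟨ vx ⟩ vx₂̸
  ...     | y , vy₃ , vy₂̸ with dist-split vy₃
  ...       | inj₁ vy₂ = contradiction vy₂ vy₂̸
  ...       | inj₂ (b , vb₂ , by) = b , y , vb₂ , (λ vb₁ → vy₂̸ (dist-step vb₁ by)) , by , vy₂̸

module Neighbourhoods {n : ℕ} (G : Graph n) where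
  open Distance G

  deg : Fin n → ℕ
  deg u = ∑[ x < n ] ⟦ adj G u x ⟧

  degree-∑ : ∀ u → degree G u ≡ deg u
  degree-∑ u = trans (length-filter (adj G u) (allFin n)) (listSum-allFin {n} _)

  closed : Fin n → Fin n → Bool
  closed u x = does (x ≟ u) ∨ adj G u x

  closed-dist : ∀ {u x} → T (closed u x) → Dist≤ 1 u x
  closed-dist {u} {x} t with Equivalence.to T-∨ t
  ... | inj₁ x≡u = dist-weaken (dist-zero (sym (does⇒ (x ≟ u) x≡u)))
  ... | inj₂ a = dist-adj a

  closed-size : ∀ u → ∑[ x < n ] ⟦ closed u x ⟧ ≡ suc (deg u)
  closed-size u = begin
    ∑[ x < n ] ⟦ closed u x ⟧
      ≡⟨ sum-cong-≗ {n} (λ x → ⟦⟧-disjoint (does (x ≟ u)) (adj G u x) (loopless x)) ⟩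
    ∑[ x < n ] (⟦ does (x ≟ u) ⟧ + ⟦ adj G u x ⟧)
      ≡⟨ ∑-distrib-+ (λ x → ⟦ does (x ≟ u) ⟧) (λ x → ⟦ adj G u x ⟧) ⟩
    ∑[ x < n ] ⟦ does (x ≟ u) ⟧ + deg u
      ≡⟨ cong (_+ deg u) (∑-singleton u) ⟩
    suc (deg u) ∎
    where
    open ≡-Reasoning
    loopless : ∀ x → T (does (x ≟ u)) → ¬ Adj u x
    loopless x x≡u a = adj-irrefl (subst (Adj u) (does⇒ (x ≟ u) x≡u) a)

  cube-intro : ∀ {u v} → u ≢ v → Dist≤ 3 u v → T (cubeAdj G u v)
  cube-intro {u} {v} u≢v ⟨ r ⟩ = Equivalence.from T-∧ (¬⇒not-does (u ≟ v) u≢v , r)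

  cube-sym : ∀ u v → cubeAdj G u v ≡ cubeAdj G v u
  cube-sym u v = T-extensional (flip u v) (flip v u)
    where
    flip : ∀ a b → T (cubeAdj G a b) → T (cubeAdj G b a)
    flip a b t =
      let (a≢b , r) = Equivalence.to T-∧ t
      in cube-intro (not-does⇒¬ (a ≟ b) a≢b ∘ sym) (dist-sym ⟨ r ⟩)

  cube-irrefl : ∀ u → cubeAdj G u u ≡ false
  cube-irrefl u rewrite dec-true (u ≟ u) refl = refl

  -- far(v) = {x | 2 ≤ dist(v,x) ≤ 3}: the G³-neighbours of v that are not G-neighbours
  far : Fin n → Fin n → Bool
  far v x = cubeAdj G v x ∧ not (adj G v x)

  D : Fin n → ℕ
  D v = ∑[ x < n ] ⟦ far v x ⟧

  far-intro : ∀ {v x} → v ≢ x → Dist≤ 3 v x → ¬ Adj v x → T (far v x)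
  far-intro v≢x r ¬a = Equivalence.from T-∧ (cube-intro v≢x r , T-not ¬a)

  cube-split : ∀ u v → ⟦ cubeAdj G u v ⟧ ≡ ⟦ adj G u v ⟧ + ⟦ far u v ⟧
  cube-split u v = ⟦⟧-split (adj G u v) (cubeAdj G u v) adj⇒cube
    where
    adj⇒cube : Adj u v → T (cubeAdj G u v)
    adj⇒cube a = cube-intro (λ u≡v → adj-irrefl (subst (Adj u) (sym u≡v) a))
                            (dist-weaken (dist-weaken (dist-adj a)))

  ball₃-covered : ∀ {v x} → Dist≤ 3 v x → T (closed v x ∨ far v x)
  ball₃-covered {v} {x} vx with T? (closed v x)
  ... | yes in-closed = Equivalence.from T-∨ (inj₁ in-closed)
  ... | no ¬closed = Equivalence.from T-∨ (inj₂ (far-intro v≢x vx ¬adj))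
    where
    v≢x : v ≢ x
    v≢x v≡x = ¬closed (Equivalence.from T-∨ (inj₁ (⇒does (x ≟ v) (sym v≡x))))
    ¬adj : ¬ Adj v x
    ¬adj a = ¬closed (Equivalence.from T-∨ (inj₂ a))

module LocalBound {n : ℕ} (G : Graph n) (d : ℕ)
                  (regular : ∀ u → Neighbourhoods.deg G u ≡ d) where
  open Distance G
  open Neighbourhoods G

  S : Fin n → ℕ
  S v = ∑[ a < n ] (⟦ adj G v a ⟧ * D a)

  closed-size-d : ∀ u → ∑[ x < n ] ⟦ closed u x ⟧ ≡ suc d
  closed-size-d u = trans (closed-size u) (cong suc (regular u))

  -- Case (B): if v sees every vertex within distance 2 but p and q are at
  -- distance ≥ 3, then N[p] and N[q] are disjoint subsets of N[v] ∪ far(v).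
  far-large : ∀ {v p q} → (∀ x → Dist≤ 2 v x) → ¬ Dist≤ 2 p q → suc d ≤ D v
  far-large {v} {p} {q} near apart = +-cancelˡ-≤ (suc d) (suc d) (D v) (begin
    suc d + suc d
      ≡⟨ cong₂ _+_ (closed-size-d p) (closed-size-d q) ⟨
    ∑[ x < n ] ⟦ closed p x ⟧ + ∑[ x < n ] ⟦ closed q x ⟧
      ≡⟨ ∑-distrib-+ (λ x → ⟦ closed p x ⟧) (λ x → ⟦ closed q x ⟧) ⟨
    ∑[ x < n ] (⟦ closed p x ⟧ + ⟦ closed q x ⟧)
      ≤⟨ ∑-mono pointwise ⟩
    ∑[ x < n ] (⟦ closed v x ⟧ + ⟦ far v x ⟧)
      ≡⟨ ∑-distrib-+ (λ x → ⟦ closed v x ⟧) (λ x → ⟦ far v x ⟧) ⟩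
    ∑[ x < n ] ⟦ closed v x ⟧ + D v
      ≡⟨ cong (_+ D v) (closed-size-d v) ⟩
    suc d + D v ∎)
    where
    open ≤-Reasoning
    pointwise : ∀ x → ⟦ closed p x ⟧ + ⟦ closed q x ⟧ ≤ ⟦ closed v x ⟧ + ⟦ far v x ⟧
    pointwise x = begin
      ⟦ closed p x ⟧ + ⟦ closed q x ⟧
        ≡⟨ ⟦⟧-disjoint (closed p x) (closed q x) disjoint ⟨
      ⟦ closed p x ∨ closed q x ⟧
        ≤⟨ ⟦⟧-cover (closed v x) (far v x) (λ _ → ball₃-covered (dist-weaken (near x))) ⟩
      ⟦ closed v x ⟧ + ⟦ far v x ⟧ ∎
      where
      disjoint : T (closed p x) → ¬ T (closed q x)
      disjoint px qx = apart (dist-trans (closed-dist px) (dist-sym (closed-dist qx)))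

  module NearFar {v b y : Fin n} (vb₂ : Dist≤ 2 v b) (vb₁̸ : ¬ Dist≤ 1 v b)
                 (by : Adj b y) (vy₂̸ : ¬ Dist≤ 2 v y) where

    common : Fin n → Bool
    common a = adj G v a ∧ adj G b a

    c : ℕ
    c = ∑[ a < n ] ⟦ common a ⟧

    b-far : T (far v b)
    b-far = far-intro (λ v≡b → vb₁̸ (dist-weaken (dist-zero v≡b)))
                      (dist-weaken vb₂) (vb₁̸ ∘ dist-adj)

    closed-b-covered : ∀ x → T (closed b x) → T (common x ∨ far v x)
    closed-b-covered x bx with Equivalence.to T-∨ bx
    ... | inj₁ x≡b = Equivalence.from T-∨ (inj₂ (subst (T ∘ far v) (sym (does⇒ (x ≟ b) x≡b)) b-far))
    ... | inj₂ b~x with T? (adj G v x)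
    ...   | yes v~x = Equivalence.from T-∨ (inj₁ (Equivalence.from T-∧ (v~x , b~x)))
    ...   | no v≁x = Equivalence.from T-∨ (inj₂ (far-intro v≢x (dist-step vb₂ b~x) v≁x))
      where
      v≢x : v ≢ x
      v≢x v≡x = vb₁̸ (dist-adj (adj-sym (subst (Adj b) (sym v≡x) b~x)))

    common-or-far : suc d ≤ c + D v
    common-or-far = begin
      suc d                                       ≡⟨ closed-size-d b ⟨
      ∑[ x < n ] ⟦ closed b x ⟧                   ≤⟨ ∑-mono (λ x → ⟦⟧-cover (common x) (far v x) (closed-b-covered x)) ⟩
      ∑[ x < n ] (⟦ common x ⟧ + ⟦ far v x ⟧)     ≡⟨ ∑-distrib-+ (⟦_⟧ ∘ common) (λ x → ⟦ far v x ⟧) ⟩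
      c + D v                                     ∎
      where open ≤-Reasoning

    v-neighbour-not-adj-y : ∀ {w} → Adj v w → ¬ Adj w y
    v-neighbour-not-adj-y v~w w~y = vy₂̸ (dist-step (dist-adj v~w) w~y)

    -- for a ∈ C: N[y] ⊆ far(v) ∪ far(a), and y ∈ far(v) ∩ far(a)
    module _ {a : Fin n} (v~a : Adj v a) (b~a : Adj b a) where

      y-far-from-both : T (far v y ∧ far a y)
      y-far-from-both = Equivalence.from T-∧ (far-v , far-a)
        where
        far-v : T (far v y)
        far-v = far-intro (λ v≡y → vy₂̸ (subst (Dist≤ 2 v) v≡y (dist-self 2)))
                          (dist-step vb₂ by) (λ v~y → vy₂̸ (dist-weaken (dist-adj v~y)))
        far-a : T (far a y)
        far-a = far-intro (λ a≡y → vy₂̸ (dist-weaken (dist-adj (subst (Adj v) a≡y v~a))))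
                          (dist-weaken (dist-step (dist-adj (adj-sym b~a)) by))
                          (v-neighbour-not-adj-y v~a)

      closed-y-covered : ∀ x → T (closed y x) → T (far v x ∨ far a x)
      closed-y-covered x yx with Equivalence.to T-∨ yx
      ... | inj₁ x≡y = Equivalence.from T-∨ (inj₁ (subst (T ∘ far v) (sym (does⇒ (x ≟ y) x≡y))
                                                        (proj₁ (Equivalence.to T-∧ y-far-from-both))))
      ... | inj₂ y~x with T? (adj G a x)
      ...   | yes a~x = Equivalence.from T-∨ (inj₁ (far-intro v≢x (dist-weaken (dist-step (dist-adj v~a) a~x)) v≁x))
        where
        v≢x : v ≢ x
        v≢x v≡x = vy₂̸ (dist-weaken (dist-sym (dist-adj (subst (Adj y) (sym v≡x) y~x))))
        v≁x : ¬ Adj v x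
        v≁x v~x = v-neighbour-not-adj-y v~x (adj-sym y~x)
      ...   | no a≁x = Equivalence.from T-∨ (inj₂ (far-intro a≢x (dist-step (dist-step (dist-adj (adj-sym b~a)) by) y~x) a≁x))
        where
        a≢x : a ≢ x
        a≢x a≡x = v-neighbour-not-adj-y v~a (adj-sym (subst (Adj y) (sym a≡x) y~x))

      pair-bound : suc (suc d) ≤ D v + D a
      pair-bound = begin
        suc (suc d)
          ≡⟨ +-comm 1 (suc d) ⟩
        suc d + 1
          ≡⟨ cong₂ _+_ (closed-size-d y) (∑-singleton y) ⟨
        ∑[ x < n ] ⟦ closed y x ⟧ + ∑[ x < n ] ⟦ does (x ≟ y) ⟧
          ≡⟨ ∑-distrib-+ (λ x → ⟦ closed y x ⟧) (λ x → ⟦ does (x ≟ y) ⟧) ⟨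
        ∑[ x < n ] (⟦ closed y x ⟧ + ⟦ does (x ≟ y) ⟧)
          ≤⟨ ∑-mono pointwise ⟩
        ∑[ x < n ] (⟦ far v x ⟧ + ⟦ far a x ⟧)
          ≡⟨ ∑-distrib-+ (λ x → ⟦ far v x ⟧) (λ x → ⟦ far a x ⟧) ⟩
        D v + D a ∎
        where
        open ≤-Reasoning
        pointwise : ∀ x → ⟦ closed y x ⟧ + ⟦ does (x ≟ y) ⟧ ≤ ⟦ far v x ⟧ + ⟦ far a x ⟧
        pointwise x = begin
          ⟦ closed y x ⟧ + ⟦ does (x ≟ y) ⟧
            ≤⟨ +-mono-≤ (⟦⟧-mono (closed-y-covered x))
                        (⟦⟧-mono (λ x≡y → subst (λ z → T (far v z ∧ far a z))
                                                (sym (does⇒ (x ≟ y) x≡y)) y-far-from-both)) ⟩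
          ⟦ far v x ∨ far a x ⟧ + ⟦ far v x ∧ far a x ⟧
            ≡⟨ ⟦⟧-∨∧ (far v x) (far a x) ⟨
          ⟦ far v x ⟧ + ⟦ far a x ⟧ ∎

    weighted : c * suc (suc d) ≤ c * D v + S v
    weighted = begin
      c * suc (suc d)
        ≡⟨ *-distribʳ-sum (suc (suc d)) (⟦_⟧ ∘ common) ⟩
      ∑[ a < n ] (⟦ common a ⟧ * suc (suc d))
        ≤⟨ ∑-mono (λ a → ⟦⟧-weighted (suc (suc d)) (D v) (D a) (proj₁ ∘ common-adj a) (common-bound a)) ⟩
      ∑[ a < n ] (⟦ common a ⟧ * D v + ⟦ adj G v a ⟧ * D a)
        ≡⟨ ∑-distrib-+ (λ a → ⟦ common a ⟧ * D v) (λ a → ⟦ adj G v a ⟧ * D a) ⟩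
      ∑[ a < n ] (⟦ common a ⟧ * D v) + S v
        ≡⟨ cong (_+ S v) (*-distribʳ-sum (D v) (⟦_⟧ ∘ common)) ⟨
      c * D v + S v ∎
      where
      open ≤-Reasoning
      common-adj : ∀ a → T (common a) → Adj v a × Adj b a
      common-adj a = Equivalence.to T-∧
      common-bound : ∀ a → T (common a) → suc (suc d) ≤ D v + D a
      common-bound a t = let (v~a , b~a) = common-adj a t in pair-bound v~a b~a

    bound : d * d ≤ 3 * (d * D v + S v)
    bound = near-far-bound d (D v) c (S v) common-or-far weighted

  local-bound : Connected G → DiamGe3 G → ∀ v → d * d ≤ 3 * (d * D v + S v)
  local-bound connected (p , q , pq₂̸) v with all? (dist≤? 2 v)
  ... | yes near = begin
    d * d                   ≤⟨ *-monoʳ-≤ d (≤-trans (n≤1+n d) (far-large {p = p} {q = q} near (pq₂̸ ∘ holds))) ⟩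
    d * D v                 ≤⟨ m≤n*m (d * D v) 3 ⟩
    3 * (d * D v)           ≤⟨ *-monoʳ-≤ 3 (m≤m+n (d * D v) (S v)) ⟩
    3 * (d * D v + S v)     ∎
    where open ≤-Reasoning
  ... | no ¬near =
    let (b , y , vb₂ , vb₁̸ , by , vy₂̸) = distance-three connected ¬near
    in NearFar.bound vb₂ vb₁̸ by vy₂̸

module Summation {n : ℕ} (G : Graph n) (d : ℕ)
                 (regular : ∀ u → Neighbourhoods.deg G u ≡ d) where
  open Neighbourhoods G
  open LocalBound G d regular

  ΣD : ℕ
  ΣD = ∑[ v < n ] D v

  ∑-deg : ∑[ u < n ] deg u ≡ n * d
  ∑-deg = trans (sum-cong-≗ {n} regular) (∑-const n d)

  -- each D(a) is counted once for each of the d neighbours of a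
  ∑-S : ∑[ v < n ] S v ≡ d * ΣD
  ∑-S = begin
    ∑[ v < n ] ∑[ a < n ] (⟦ adj G v a ⟧ * D a)
      ≡⟨ ∑-comm (λ v a → ⟦ adj G v a ⟧ * D a) ⟩
    ∑[ a < n ] ∑[ v < n ] (⟦ adj G v a ⟧ * D a)
      ≡⟨ sum-cong-≗ {n} (λ a → *-distribʳ-sum (D a) (λ v → ⟦ adj G v a ⟧)) ⟨
    ∑[ a < n ] (∑[ v < n ] ⟦ adj G v a ⟧ * D a)
      ≡⟨ sum-cong-≗ {n} (λ a → cong (_* D a) (trans (sum-cong-≗ {n} (λ v → cong ⟦_⟧ (Graph.sym G v a)))
                                                      (regular a))) ⟩
    ∑[ a < n ] (d * D a)
      ≡⟨ *-distribˡ-sum d D ⟨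
    d * ΣD ∎
    where open ≡-Reasoning

  far-total : Connected G → DiamGe3 G → n * d ≤ 6 * ΣD
  far-total connected diam = cancel-degree n d (6 * ΣD) (begin
    d * (n * d)
      ≡⟨ rearrange n d ⟩
    n * (d * d)
      ≡⟨ ∑-const n (d * d) ⟨
    ∑[ v < n ] (d * d)
      ≤⟨ ∑-mono (local-bound connected diam) ⟩
    ∑[ v < n ] (3 * (d * D v + S v))
      ≡⟨ *-distribˡ-sum 3 (λ v → d * D v + S v) ⟨
    3 * ∑[ v < n ] (d * D v + S v)
      ≡⟨ cong (3 *_) (∑-distrib-+ (λ v → d * D v) S) ⟩
    3 * (∑[ v < n ] (d * D v) + ∑[ v < n ] S v)
      ≡⟨ cong (3 *_) (cong₂ _+_ (*-distribˡ-sum d D) (sym ∑-S)) ⟨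
    3 * (d * ΣD + d * ΣD)
      ≡⟨ double d ΣD ⟩
    d * (6 * ΣD) ∎)
    where
    open ≤-Reasoning
    rearrange : ∀ n d → d * (n * d) ≡ n * (d * d)
    rearrange = solve-∀
    double : ∀ d x → 3 * (d * x + d * x) ≡ d * (6 * x)
    double = solve-∀

  edges-twice : 2 * e G ≡ n * d
  edges-twice = trans (sym (handshake (adj G) (Graph.sym G) (Graph.irrefl G))) ∑-deg

  cube-edges-twice : 2 * e-cube G ≡ n * d + ΣD
  cube-edges-twice = begin
    2 * e-cube G
      ≡⟨ handshake (cubeAdj G) cube-sym cube-irrefl ⟨
    ∑[ u < n ] ∑[ v < n ] ⟦ cubeAdj G u v ⟧
      ≡⟨ sum-cong-≗ {n} (λ u → trans (sum-cong-≗ {n} (cube-split u))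
                                     (∑-distrib-+ (λ v → ⟦ adj G u v ⟧) (λ v → ⟦ far u v ⟧))) ⟩
    ∑[ u < n ] (deg u + D u)
      ≡⟨ ∑-distrib-+ deg D ⟩
    ∑[ u < n ] deg u + ΣD
      ≡⟨ cong (_+ ΣD) ∑-deg ⟩
    n * d + ΣD ∎
    where open ≡-Reasoning

theorem4 : ∀ {n : ℕ} (G : Graph n) → Regular G → Connected G → DiamGe3 G →
    7 * e G ≤ 6 * e-cube G
theorem4 {n} G (d , degree≡d) connected diam =
  ratio-bound (e G) (e-cube G) (n * d) ΣD edges-twice cube-edges-twice (far-total connected diam)
  where
  regular : ∀ u → Neighbourhoods.deg G u ≡ d
  regular u = trans (sym (Neighbourhoods.degree-∑ G u)) (degree≡d u)
  open Summation G d regular
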